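{- Let $\mathscr{L}$ be a language, $\mathcal{S} = (\Sigma, I)$ a semantic structure for it, and $A$ an abstract domain of $\wp(\Sigma)_\subseteq$ given by a Galois insertion $(\alpha,\wp(\Sigma),A,\gamma)$. (1) If $\mathcal{S}^\sharp_1 = (A, I^\sharp_1)$ and $\mathcal{S}^\sharp_2 = (A, I^\sharp_2)$ are abstract semantic structures on $A$ whose abstract semantics $[\![\cdot]\!]_{\mathcal{S}^\sharp_1}$ and $[\![\cdot]\!]_{\mathcal{S}^\sharp_2}$ are both strongly preserving for $\mathscr{L}$, then $[\![\cdot]\!]_{\mathcal{S}^\sharp_1} = [\![\cdot]\!]_{\mathcal{S}^\sharp_2}$. (2) If $\mathcal{S}^\sharp = (A, I^\sharp)$ is an abstract semantic structure on $A$ such that $[\![\cdot]\!]_{\mathcal{S}^\sharp}$ is strongly preserving for $\mathscr{L}$, then $[\![\cdot]\!]^A_{\mathcal{S}}$ is strongly preserving for $\mathscr{L}$.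
   Context: A language $\mathscr{L}$ has formulas $\varphi ::= p \mid f(\varphi_1,\dots,\varphi_n)$, $p\in AP$, $f\in Op$ (finite) with arity $\sharp(f)>0$. A semantic structure $\mathcal{S}=(\Sigma,I)$ gives $I(p)\subseteq\Sigma$ and $I(f):\wp(\Sigma)^{\sharp(f)}\to\wp(\Sigma)$, with concrete semantics $[\![p]\!]_{\mathcal{S}}=I(p)$, $[\![f(\vec\varphi)]\!]_{\mathcal{S}}=I(f)([\![\varphi_1]\!]_{\mathcal{S}},\dots)$. An abstract semantic structure $(A,I^\sharp)$ gives $I^\sharp(p)\in A$, $I^\sharp(f):A^{\sharp(f)}\to A$ and the inductively defined abstract semantics $[\![\cdot]\!]_{\mathcal{S}^\sharp}:\mathscr{L}\to A$. The best correct approximation structure $\mathcal{S}^A=(A,I^A)$ has $I^A(p)=\alpha(I(p))$ and $I^A(f)(a_1,\dots,a_n)=\alpha(I(f)(\gamma(a_1),\dots,\gamma(a_n)))$; its semantics is written $[\![\cdot]\!]^A_{\mathcal{S}}$. Galois insertion: $\alpha(S)\le a\iff S\subseteq\gamma(a)$, $\alpha\circ\gamma=\mathrm{id}$. An abstract semantics $[\![\cdot]\!]_{\mathcal{S}^\sharp}$ is strongly preserving for $\mathscr{L}$ if for all $\varphi$ and $S\subseteq\Sigma$: $\alpha(S)\le_A[\![\varphi]\!]_{\mathcal{S}^\sharp}\iff S\subseteq[\![\varphi]\!]_{\mathcal{S}}$. -}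

module Defs where

open import Level using (Level; _⊔_; suc; 0ℓ)
open import Data.Nat using (ℕ; _<_)
open import Data.Fin using (Fin)
open import Data.Product using (_×_)
open import Relation.Unary using (Pred; _⊆_; _≐_)
open import Relation.Binary.Bundles using (Poset)

record Language : Set₁ where
  field
    AP       : Set
    nOp      : ℕ
    arity    : Fin nOp → ℕ
    arity>0  : ∀ f → 0 < arity f

  Op : Set
  Op = Fin nOp

data Formula (L : Language) : Set where
  atom : Language.AP L → Formula L
  app  : (f : Language.Op L) → (Fin (Language.arity L f) → Formula L) → Formula L

-- Subsets of Σ are modelled as predicates Σ → Set; ℘(Σ) is ordered by ⊆.
-- Since sets are extensional, interpretations of operators must respect
-- extensional equality (≐) of subsets.
record SemStructure (L : Language) : Set₁ where
  open Language L
  field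
    State : Set
    I-ap  : AP → Pred State 0ℓ
    I-op  : (f : Op) → (Fin (arity f) → Pred State 0ℓ) → Pred State 0ℓ
    I-op-cong : ∀ f (Ss Ts : Fin (arity f) → Pred State 0ℓ) →
                (∀ i → Ss i ≐ Ts i) → I-op f Ss ≐ I-op f Ts

⟦_⟧ : ∀ {L} → Formula L → (S : SemStructure L) → Pred (SemStructure.State S) 0ℓ
⟦ atom p ⟧ S = SemStructure.I-ap S p
⟦ app f φs ⟧ S = SemStructure.I-op S f (λ i → ⟦ φs i ⟧ S)

record GaloisInsertion (Σ : Set) {a ℓ₁ ℓ₂ : Level} (A : Poset a ℓ₁ ℓ₂)
       : Set (suc 0ℓ ⊔ a ⊔ ℓ₁ ⊔ ℓ₂) where
  open Poset A renaming (Carrier to |A|)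
  field
    α     : Pred Σ 0ℓ → |A|
    γ     : |A| → Pred Σ 0ℓ
    α⊣γ   : ∀ S x → (α S ≤ x → S ⊆ γ x) × (S ⊆ γ x → α S ≤ x)
    α∘γ   : ∀ x → α (γ x) ≈ x

record AbsStructure (L : Language) {a ℓ₁ ℓ₂ : Level} (A : Poset a ℓ₁ ℓ₂)
       : Set (a ⊔ 0ℓ) where
  open Language L
  field
    I♯-ap : AP → Poset.Carrier A
    I♯-op : (f : Op) → (Fin (arity f) → Poset.Carrier A) → Poset.Carrier A

⟦_⟧♯ : ∀ {L a ℓ₁ ℓ₂} {A : Poset a ℓ₁ ℓ₂} → Formula L → AbsStructure L A → Poset.Carrier A
⟦ atom p ⟧♯ S = AbsStructure.I♯-ap S p
⟦ app f φs ⟧♯ S = AbsStructure.I♯-op S f (λ i → ⟦ φs i ⟧♯ S)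

bca : ∀ {L a ℓ₁ ℓ₂} {A : Poset a ℓ₁ ℓ₂} (S : SemStructure L) →
      GaloisInsertion (SemStructure.State S) A → AbsStructure L A
bca S G = record
  { I♯-ap = λ p → α (SemStructure.I-ap S p)
  ; I♯-op = λ f as → α (SemStructure.I-op S f (λ i → γ (as i)))
  }
  where open GaloisInsertion G

StronglyPreserving : ∀ {L a ℓ₁ ℓ₂} {A : Poset a ℓ₁ ℓ₂} (S : SemStructure L) →
  GaloisInsertion (SemStructure.State S) A → AbsStructure L A → Set (suc 0ℓ ⊔ ℓ₂)
StronglyPreserving {A = A} S G S♯ =
  ∀ (φ : Formula _) (X : Pred (SemStructure.State S) 0ℓ) →
    (Poset._≤_ A (GaloisInsertion.α G X) (⟦ φ ⟧♯ S♯) → X ⊆ ⟦ φ ⟧ S)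
    × (X ⊆ ⟦ φ ⟧ S → Poset._≤_ A (GaloisInsertion.α G X) (⟦ φ ⟧♯ S♯))

{-# OPTIONS --safe #-}
-- Taking X = ⟦φ⟧ and X = γ ⟦φ⟧♯ forces ⟦φ⟧♯ ≈ α ⟦φ⟧,
-- which is part (1), and forces ⟦φ⟧ to be closed under γ ∘ α. Closedness of
-- all ⟦φ⟧ means that γ ∘ α is the identity on the arguments fed to every
-- operator, so by induction the best correct approximation also computes
-- α ⟦φ⟧; and α Y always strongly represents a closed Y, giving part (2).
module Submission where

open import Defs
open import Level using (Level; _⊔_; suc; 0ℓ)
open import Data.Product using (_×_; _,_; proj₁; proj₂)
open import Relation.Binary.Bundles using (Poset)
open import Relation.Unary using (Pred; _⊆_; _≐_)
open import Relation.Unary.Properties using (≐-trans)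

module GaloisInsertionProperties
  {Σ : Set} {a ℓ₁ ℓ₂ : Level} {A : Poset a ℓ₁ ℓ₂} (G : GaloisInsertion Σ A) where

  open Poset A
  open GaloisInsertion G

  γα-extensive : ∀ {Y} → Y ⊆ γ (α Y)
  γα-extensive {Y} = proj₁ (α⊣γ Y (α Y)) refl

  α-mono : ∀ {X Y} → X ⊆ Y → α X ≤ α Y
  α-mono {X} X⊆Y = proj₂ (α⊣γ X _) (λ x∈X → γα-extensive (X⊆Y x∈X))

  α-cong : ∀ {X Y} → X ≐ Y → α X ≈ α Y
  α-cong (X⊆Y , Y⊆X) = antisym (α-mono X⊆Y) (α-mono Y⊆X)

  γ-mono : ∀ {x y} → x ≤ y → γ x ⊆ γ y
  γ-mono {x} x≤y = proj₁ (α⊣γ (γ x) _) (trans (reflexive (α∘γ x)) x≤y)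

  γ-cong : ∀ {x y} → x ≈ y → γ x ≐ γ y
  γ-cong x≈y = γ-mono (reflexive x≈y) , γ-mono (reflexive (Eq.sym x≈y))

  γα-Closed : Pred Σ 0ℓ → Set
  γα-Closed Y = γ (α Y) ⊆ Y

  γα-closed⇒≐ : ∀ {Y} → γα-Closed Y → γ (α Y) ≐ Y
  γα-closed⇒≐ closed = closed , γα-extensive

  -- StronglyPreserving S G S♯ unfolds to ∀ φ → Represents (⟦ φ ⟧♯ S♯) (⟦ φ ⟧ S).
  Represents : Carrier → Pred Σ 0ℓ → Set (suc 0ℓ ⊔ ℓ₂)
  Represents x Y = ∀ X → (α X ≤ x → X ⊆ Y) × (X ⊆ Y → α X ≤ x)

  Represents-respˡ-≈ : ∀ {x y Y} → x ≈ y → Represents x Y → Represents y Y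
  Represents-respˡ-≈ x≈y rep X =
      (λ αX≤y → proj₁ (rep X) (trans αX≤y (reflexive (Eq.sym x≈y))))
    , (λ X⊆Y → trans (proj₂ (rep X) X⊆Y) (reflexive x≈y))

  represents⇒≈α : ∀ {x Y} → Represents x Y → x ≈ α Y
  represents⇒≈α {x} {Y} rep = antisym x≤αY (proj₂ (rep Y) (λ y∈Y → y∈Y))
    where
    γx⊆Y : γ x ⊆ Y
    γx⊆Y = proj₁ (rep (γ x)) (reflexive (α∘γ x))

    x≤αY : x ≤ α Y
    x≤αY = trans (reflexive (Eq.sym (α∘γ x))) (α-mono γx⊆Y)

  represents⇒γα-closed : ∀ {x Y} → Represents x Y → γα-Closed Y
  represents⇒γα-closed {x} {Y} rep = proj₁ (rep (γ (α Y))) αγαY≤x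
    where
    αγαY≤x : α (γ (α Y)) ≤ x
    αγαY≤x = trans (reflexive (α∘γ (α Y))) (proj₂ (rep Y) (λ y∈Y → y∈Y))

  γα-closed⇒represents-α : ∀ {Y} → γα-Closed Y → Represents (α Y) Y
  γα-closed⇒represents-α {Y} closed X =
      (λ αX≤αY x∈X → closed (proj₁ (α⊣γ X (α Y)) αX≤αY x∈X))
    , α-mono

module _ {a ℓ₁ ℓ₂ : Level} {L : Language} (S : SemStructure L) {A : Poset a ℓ₁ ℓ₂}
         (G : GaloisInsertion (SemStructure.State S) A) where

  open Poset A using (_≈_; module Eq)
  open GaloisInsertion G using (α; γ)
  open GaloisInsertionProperties G
  open SemStructure S using (I-op-cong)

  bca-≈α : (∀ φ → γα-Closed (⟦ φ ⟧ S)) → ∀ φ → ⟦ φ ⟧♯ (bca S G) ≈ α (⟦ φ ⟧ S)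
  bca-≈α closed (atom p)   = Eq.refl
  bca-≈α closed (app f φs) = α-cong (I-op-cong f _ _ γ⟦φs⟧♯≐⟦φs⟧)
    where
    γ⟦φs⟧♯≐⟦φs⟧ : ∀ i → γ (⟦ φs i ⟧♯ (bca S G)) ≐ ⟦ φs i ⟧ S
    γ⟦φs⟧♯≐⟦φs⟧ i = ≐-trans (γ-cong (bca-≈α closed (φs i)))
                            (γα-closed⇒≐ (closed (φs i)))

  bca-stronglyPreserving : (∀ φ → γα-Closed (⟦ φ ⟧ S)) → StronglyPreserving S G (bca S G)
  bca-stronglyPreserving closed φ =
    Represents-respˡ-≈ (Eq.sym (bca-≈α closed φ)) (γα-closed⇒represents-α (closed φ))

lemma5p4 : ∀ {a ℓ₁ ℓ₂ : Level} (L : Language) (S : SemStructure L) (A : Poset a ℓ₁ ℓ₂)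
             (G : GaloisInsertion (SemStructure.State S) A) →
             (∀ (S₁ S₂ : AbsStructure L A) →
                StronglyPreserving S G S₁ → StronglyPreserving S G S₂ →
                ∀ (φ : Formula L) → Poset._≈_ A (⟦ φ ⟧♯ S₁) (⟦ φ ⟧♯ S₂))
             × (∀ (S♯ : AbsStructure L A) →
                StronglyPreserving S G S♯ → StronglyPreserving S G (bca S G))
lemma5p4 L S A G = unique , bca-preserves
  where
  open Poset A using (module Eq)
  open GaloisInsertionProperties G using (represents⇒≈α; represents⇒γα-closed)

  unique : ∀ S₁ S₂ → StronglyPreserving S G S₁ → StronglyPreserving S G S₂ →
           ∀ φ → Poset._≈_ A (⟦ φ ⟧♯ S₁) (⟦ φ ⟧♯ S₂)
  unique S₁ S₂ sp₁ sp₂ φ =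
    Eq.trans (represents⇒≈α (sp₁ φ)) (Eq.sym (represents⇒≈α (sp₂ φ)))

  bca-preserves : ∀ S♯ → StronglyPreserving S G S♯ → StronglyPreserving S G (bca S G)
  bca-preserves S♯ sp = bca-stronglyPreserving S G (λ φ → represents⇒γα-closed (sp φ))
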